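{- Let $G=(A,B,E)$ be a bipartite graph that is $\alpha$-stable, and let $S$ be a maximum stable set of $G$ with $S\cap A\neq\emptyset$ and $S\cap B\neq\emptyset$. Then the induced subgraph $H=G[(S\cap A)\cup(B\setminus S)]$ is $\alpha$-stable.
   Context: All graphs are finite and simple. $G[U]$ denotes the subgraph induced by $U$. $\alpha(G)$ is the largest size of a stable set (set of pairwise nonadjacent vertices); a maximum stable set is a stable set of size $\alpha(G)$. A graph is $\alpha^-$-stable if $\alpha(G-e)=\alpha(G)$ for every edge $e$; $\alpha^+$-stable if $\alpha(G+e)=\alpha(G)$ for every pair $e=xy$ of distinct nonadjacent vertices; $\alpha$-stable if both. -}

module Defs where

open import Data.Nat using (ℕ; _≤_)
open import Data.Bool using (Bool; true; false; _∧_; _∨_; not)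
open import Data.Fin using (Fin; _≟_)
open import Data.Fin.Subset using (Subset; _∈_; _⊆_; ∣_∣; ⊤)
open import Data.Vec using (tabulate)
open import Data.Product using (Σ; _×_; ∃)
open import Relation.Nullary using (¬_; Dec; yes; no)
open import Relation.Nullary.Decidable using (⌊_⌋)
open import Relation.Binary.PropositionalEquality using (_≡_)

record Graph (n : ℕ) : Set where
  field
    adj    : Fin n → Fin n → Bool
    adj-sym    : ∀ x y → adj x y ≡ adj y x
    adj-irrefl : ∀ x → adj x x ≡ false
open Graph public

Adj : ∀ {n} → Graph n → Fin n → Fin n → Set
Adj G x y = adj G x y ≡ true

samePair : ∀ {n} → Fin n → Fin n → Fin n → Fin n → Bool
samePair x y a b = (⌊ a ≟ x ⌋ ∧ ⌊ b ≟ y ⌋) ∨ (⌊ a ≟ y ⌋ ∧ ⌊ b ≟ x ⌋)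

deleteEdge : ∀ {n} → Graph n → Fin n → Fin n → Graph n
deleteEdge {n} G x y = record
  { adj = λ a b → adj G a b ∧ not (samePair x y a b)
  ; adj-sym = λ a b → symProof a b
  ; adj-irrefl = λ a → irr a }
  where
  open import Data.Bool.Properties using (∧-comm; ∨-comm)
  open import Relation.Binary.PropositionalEquality using (cong₂; refl)
  sp : ∀ a b → samePair x y a b ≡ samePair x y b a
  sp a b with a ≟ x | b ≟ y | a ≟ y | b ≟ x
  ... | yes _ | yes _ | yes _ | yes _ = refl
  ... | yes _ | yes _ | yes _ | no  _ = refl
  ... | yes _ | yes _ | no  _ | yes _ = refl
  ... | yes _ | yes _ | no  _ | no  _ = refl
  ... | yes _ | no  _ | yes _ | yes _ = refl
  ... | yes _ | no  _ | yes _ | no  _ = refl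
  ... | yes _ | no  _ | no  _ | yes _ = refl
  ... | yes _ | no  _ | no  _ | no  _ = refl
  ... | no  _ | yes _ | yes _ | yes _ = refl
  ... | no  _ | yes _ | yes _ | no  _ = refl
  ... | no  _ | yes _ | no  _ | yes _ = refl
  ... | no  _ | yes _ | no  _ | no  _ = refl
  ... | no  _ | no  _ | yes _ | yes _ = refl
  ... | no  _ | no  _ | yes _ | no  _ = refl
  ... | no  _ | no  _ | no  _ | yes _ = refl
  ... | no  _ | no  _ | no  _ | no  _ = refl
  symProof : ∀ a b → (adj G a b ∧ not (samePair x y a b)) ≡ (adj G b a ∧ not (samePair x y b a))
  symProof a b = cong₂ (λ u v → u ∧ not v) (Graph.adj-sym G a b) (sp a b)
  irr : ∀ a → (adj G a a ∧ not (samePair x y a a)) ≡ false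
  irr a rewrite Graph.adj-irrefl G a = refl

addEdge : ∀ {n} → Graph n → (x y : Fin n) → ¬ (x ≡ y) → Graph n
addEdge {n} G x y x≢y = record
  { adj = λ a b → adj G a b ∨ samePair x y a b
  ; adj-sym = λ a b → symProof a b
  ; adj-irrefl = irr }
  where
  open import Relation.Binary.PropositionalEquality using (cong₂; refl; trans; sym)
  sp : ∀ a b → samePair x y a b ≡ samePair x y b a
  sp a b with a ≟ x | b ≟ y | a ≟ y | b ≟ x
  ... | yes _ | yes _ | yes _ | yes _ = refl
  ... | yes _ | yes _ | yes _ | no  _ = refl
  ... | yes _ | yes _ | no  _ | yes _ = refl
  ... | yes _ | yes _ | no  _ | no  _ = refl
  ... | yes _ | no  _ | yes _ | yes _ = refl
  ... | yes _ | no  _ | yes _ | no  _ = refl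
  ... | yes _ | no  _ | no  _ | yes _ = refl
  ... | yes _ | no  _ | no  _ | no  _ = refl
  ... | no  _ | yes _ | yes _ | yes _ = refl
  ... | no  _ | yes _ | yes _ | no  _ = refl
  ... | no  _ | yes _ | no  _ | yes _ = refl
  ... | no  _ | yes _ | no  _ | no  _ = refl
  ... | no  _ | no  _ | yes _ | yes _ = refl
  ... | no  _ | no  _ | yes _ | no  _ = refl
  ... | no  _ | no  _ | no  _ | yes _ = refl
  ... | no  _ | no  _ | no  _ | no  _ = refl
  symProof : ∀ a b → (adj G a b ∨ samePair x y a b) ≡ (adj G b a ∨ samePair x y b a)
  symProof a b = cong₂ _∨_ (Graph.adj-sym G a b) (sp a b)
  irr : ∀ a → (adj G a a ∨ samePair x y a a) ≡ false
  irr a rewrite Graph.adj-irrefl G a with a ≟ x | a ≟ y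
  ... | yes p | yes q = Data.Empty.⊥-elim (x≢y (trans (sym p) q))
    where import Data.Empty
  ... | yes _ | no  _ = refl
  ... | no  _ | yes _ = refl
  ... | no  _ | no  _ = refl

-- Graphs restricted to a vertex set U ⊆ V(G).  The induced subgraph G[U]
-- is represented by the pair (G , U): its vertices are the members of U,
-- its edges the edges of G with both ends in U.

Stable : ∀ {n} → Graph n → Subset n → Subset n → Set
Stable G U T = T ⊆ U × (∀ x y → x ∈ T → y ∈ T → ¬ Adj G x y)

IsAlpha : ∀ {n} → Graph n → Subset n → ℕ → Set
IsAlpha G U k = (Σ (Subset _) λ T → Stable G U T × ∣ T ∣ ≡ k)
              × (∀ T → Stable G U T → ∣ T ∣ ≤ k)

MaxStable : ∀ {n} → Graph n → Subset n → Subset n → Set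
MaxStable G U T = Stable G U T × (∀ T′ → Stable G U T′ → ∣ T′ ∣ ≤ ∣ T ∣)

AlphaMinusStable : ∀ {n} → Graph n → Subset n → Set
AlphaMinusStable G U = ∀ x y → x ∈ U → y ∈ U → Adj G x y →
  ∀ k → IsAlpha G U k → IsAlpha (deleteEdge G x y) U k

AlphaPlusStable : ∀ {n} → Graph n → Subset n → Set
AlphaPlusStable G U = ∀ x y → x ∈ U → y ∈ U → (x≢y : ¬ (x ≡ y)) → ¬ Adj G x y →
  ∀ k → IsAlpha G U k → IsAlpha (addEdge G x y x≢y) U k

AlphaStable : ∀ {n} → Graph n → Subset n → Set
AlphaStable G U = AlphaMinusStable G U × AlphaPlusStable G U

-- A bipartite graph G = (A, B, E): `side x ≡ true` means x ∈ A, otherwise x ∈ B;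
-- every edge joins A and B.
IsBipartition : ∀ {n} → Graph n → (Fin n → Bool) → Set
IsBipartition G side = ∀ x y → Adj G x y → ¬ (side x ≡ side y)

sideA sideB : ∀ {n} → (Fin n → Bool) → Subset n
sideA side = tabulate side
sideB side = tabulate (λ x → not (side x))

-- Let A, B be the sides, X = S ∩ A and U = X ∪ (B ─ S). A stable set T of H[U], for H a
-- spanning subgraph of G, is disjoint from S ∩ B and has no edge to it (an edge from X
-- would lie inside S, one from B ─ S inside B). So T ∪ (S ∩ B) is stable in H, and if
-- α(H) = α(G) = |S| then |T| ≤ |S| − |S ∩ B| = |X|; thus α(H[U]) = |X|, attained by X.
-- This covers G − e by α⁻-stability of G, and bounds α((G + xy)[U]) from above. For the
-- lower bound take a stable set T of G + xy of size |S|. Exchanging S and T across the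
-- bipartition, (S ∪ T) ∩ A ∪ (S ∩ T ∩ B) is stable in G, hence has at most |S| elements;
-- as the two exchanged sets together have |S| + |T| elements, the partner
-- (S ∩ T ∩ A) ∪ (S ∪ T) ∩ B ⊆ (T ∩ U) ∪ (S ∩ B) has at least |T| = |S|. This gives
-- |T ∩ U| ≥ |X| for the stable set T ∩ U of (G + xy)[U].

module Submission where

open import Defs
open import Data.Nat using (suc; _+_; _≤_)
open import Data.Nat.Properties
  using (+-suc; +-comm; +-identityʳ; ≤-antisym; ≤-reflexive; m≤m+n; +-monoʳ-≤; +-cancelˡ-≤; +-cancelʳ-≤;
         +-commutativeSemigroup; module ≤-Reasoning)
open import Algebra.Properties.CommutativeSemigroup +-commutativeSemigroup using (interchange)
open import Data.Bool using (Bool; true; false; not; _∨_)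
open import Data.Fin using (Fin)
open import Data.Fin.Subset
  using (Subset; ⊤; _∈_; _∉_; _⊆_; _∩_; _∪_; _─_; ∣_∣; Empty; Nonempty; inside; outside)
open import Data.Fin.Subset.Properties
  using (∈⊤; ⊆⊤; ⊆-antisym; ∣⊥∣≡0; Empty-unique; p⊆q⇒∣p∣≤∣q∣; x∈p∩q⁺; x∈p∩q⁻; p∩q⊆p; p∩q⊆q;
         x∈p∪q⁺; x∈p∪q⁻; p⊆p∪q; q⊆p∪q; p─q⊆p; x∈p∧x∉q⇒x∈p─q; _∈?_)
open import Data.Vec using ([]; _∷_; tabulate; here; there)
open import Data.Vec.Properties using (lookup∘tabulate; []=⇒lookup; lookup⇒[]=)
open import Data.Product using (_,_; proj₁; proj₂)
open import Data.Sum using (_⊎_; inj₁; inj₂; [_,_]′)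
open import Function using (_∘_)
open import Relation.Nullary using (¬_; yes; no)
open import Relation.Binary.PropositionalEquality
  using (_≡_; refl; sym; trans; cong; cong₂; subst; module ≡-Reasoning)

∣p∪q∣+∣p∩q∣≡∣p∣+∣q∣ : ∀ {n} (p q : Subset n) → ∣ p ∪ q ∣ + ∣ p ∩ q ∣ ≡ ∣ p ∣ + ∣ q ∣
∣p∪q∣+∣p∩q∣≡∣p∣+∣q∣ [] [] = refl
∣p∪q∣+∣p∩q∣≡∣p∣+∣q∣ (inside ∷ p) (inside ∷ q) = cong suc (begin
  ∣ p ∪ q ∣ + suc ∣ p ∩ q ∣    ≡⟨ +-suc _ _ ⟩
  suc (∣ p ∪ q ∣ + ∣ p ∩ q ∣)  ≡⟨ cong suc (∣p∪q∣+∣p∩q∣≡∣p∣+∣q∣ p q) ⟩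
  suc (∣ p ∣ + ∣ q ∣)          ≡⟨ +-suc _ _ ⟨
  ∣ p ∣ + suc ∣ q ∣            ∎)
  where open ≡-Reasoning
∣p∪q∣+∣p∩q∣≡∣p∣+∣q∣ (inside ∷ p) (outside ∷ q) = cong suc (∣p∪q∣+∣p∩q∣≡∣p∣+∣q∣ p q)
∣p∪q∣+∣p∩q∣≡∣p∣+∣q∣ (outside ∷ p) (inside ∷ q) =
  trans (cong suc (∣p∪q∣+∣p∩q∣≡∣p∣+∣q∣ p q)) (sym (+-suc _ _))
∣p∪q∣+∣p∩q∣≡∣p∣+∣q∣ (outside ∷ p) (outside ∷ q) = ∣p∪q∣+∣p∩q∣≡∣p∣+∣q∣ p q

∣p∪q∣≤∣p∣+∣q∣ : ∀ {n} (p q : Subset n) → ∣ p ∪ q ∣ ≤ ∣ p ∣ + ∣ q ∣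
∣p∪q∣≤∣p∣+∣q∣ p q = subst (∣ p ∪ q ∣ ≤_) (∣p∪q∣+∣p∩q∣≡∣p∣+∣q∣ p q) (m≤m+n _ _)

∣p∪q∣≡∣p∣+∣q∣ : ∀ {n} (p q : Subset n) → Empty (p ∩ q) → ∣ p ∪ q ∣ ≡ ∣ p ∣ + ∣ q ∣
∣p∪q∣≡∣p∣+∣q∣ {n} p q disjoint = begin
  ∣ p ∪ q ∣              ≡⟨ +-identityʳ _ ⟨
  ∣ p ∪ q ∣ + 0          ≡⟨ cong (∣ p ∪ q ∣ +_) ∣p∩q∣≡0 ⟨
  ∣ p ∪ q ∣ + ∣ p ∩ q ∣  ≡⟨ ∣p∪q∣+∣p∩q∣≡∣p∣+∣q∣ p q ⟩
  ∣ p ∣ + ∣ q ∣          ∎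
  where
  open ≡-Reasoning
  ∣p∩q∣≡0 : ∣ p ∩ q ∣ ≡ 0
  ∣p∩q∣≡0 = trans (cong ∣_∣ (Empty-unique disjoint)) (∣⊥∣≡0 n)

∪-least : ∀ {n} {p q r : Subset n} → p ⊆ r → q ⊆ r → p ∪ q ⊆ r
∪-least {p = p} {q} p⊆r q⊆r x∈p∪q = [ p⊆r , q⊆r ]′ (x∈p∪q⁻ p q x∈p∪q)

p∩r∪q∩r⊆r : ∀ {n} (p q r : Subset n) → p ∩ r ∪ q ∩ r ⊆ r
p∩r∪q∩r⊆r p q r = ∪-least (p∩q⊆q p r) (p∩q⊆q q r)

[p∩r]∩[q∩r]⊆r : ∀ {n} (p q r : Subset n) → (p ∩ r) ∩ (q ∩ r) ⊆ r
[p∩r]∩[q∩r]⊆r p q r = p∩q⊆q q r ∘ p∩q⊆q (p ∩ r) (q ∩ r)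

x∈p─q⇒x∉q : ∀ {n} {p q : Subset n} {x} → x ∈ p ─ q → x ∉ q
x∈p─q⇒x∉q {p = _ ∷ _} {outside ∷ _} here ()
x∈p─q⇒x∉q {p = _ ∷ _} {_ ∷ _} (there x∈p─q) (there x∈q) = x∈p─q⇒x∉q x∈p─q x∈q

∈-tabulate⁻ : ∀ {n} (f : Fin n → Bool) {x} → x ∈ tabulate f → f x ≡ true
∈-tabulate⁻ f {x} x∈ = trans (sym (lookup∘tabulate f x)) ([]=⇒lookup x∈)

∈-tabulate⁺ : ∀ {n} (f : Fin n → Bool) {x} → f x ≡ true → x ∈ tabulate f
∈-tabulate⁺ f {x} fx = lookup⇒[]= x (tabulate f) (trans (lookup∘tabulate f x) fx)

-- A record rather than a function type, so that G and H are inferable from a proof of G ⊑ H.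
record _⊑_ {n} (G H : Graph n) : Set where
  constructor edges⊆
  field ⊑⇒Adj : ∀ x y → Adj G x y → Adj H x y
open _⊑_

⊑-refl : ∀ {n} {G : Graph n} → G ⊑ G
⊑-refl = edges⊆ λ _ _ x~y → x~y

deleteEdge-⊑ : ∀ {n} (G : Graph n) x y → deleteEdge G x y ⊑ G
deleteEdge-⊑ G x y = edges⊆ adj-⇒
  where
  adj-⇒ : ∀ a b → Adj (deleteEdge G x y) a b → Adj G a b
  adj-⇒ a b a~b with adj G a b
  ... | true  = refl
  ... | false = a~b

⊑-addEdge : ∀ {n} (G : Graph n) x y (x≢y : ¬ x ≡ y) → G ⊑ addEdge G x y x≢y
⊑-addEdge G x y x≢y = edges⊆ λ a b a~b → cong (_∨ samePair x y a b) a~b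

Adj-sym : ∀ {n} (G : Graph n) {x y} → Adj G x y → Adj G y x
Adj-sym G {x} {y} x~y = trans (adj-sym G y x) x~y

Stable-⊑ : ∀ {n} {G H : Graph n} {U T} → G ⊑ H → Stable H U T → Stable G U T
Stable-⊑ G⊑H (T⊆U , indep) = T⊆U , λ x y x∈T y∈T → indep x y x∈T y∈T ∘ ⊑⇒Adj G⊑H x y

Stable-⊆ : ∀ {n} (G : Graph n) {U T T′} → T′ ⊆ T → Stable G U T → Stable G U T′
Stable-⊆ _ T′⊆T (T⊆U , indep) = T⊆U ∘ T′⊆T , λ x y x∈T′ y∈T′ → indep x y (T′⊆T x∈T′) (T′⊆T y∈T′)

∪-stable : ∀ {n} (G : Graph n) {U p q} → Stable G U p → Stable G U q →
  (∀ x y → x ∈ p → y ∈ q → ¬ Adj G x y) → Stable G U (p ∪ q)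
∪-stable G {p = p} {q} (p⊆U , p-indep) (q⊆U , q-indep) p≁q =
  ∪-least p⊆U q⊆U , indep
  where
  indep : ∀ x y → x ∈ p ∪ q → y ∈ p ∪ q → ¬ Adj G x y
  indep x y x∈ y∈ with x∈p∪q⁻ p q x∈ | x∈p∪q⁻ p q y∈
  ... | inj₁ x∈p | inj₁ y∈p = p-indep x y x∈p y∈p
  ... | inj₁ x∈p | inj₂ y∈q = p≁q x y x∈p y∈q
  ... | inj₂ x∈q | inj₁ y∈p = p≁q y x y∈p x∈q ∘ Adj-sym G
  ... | inj₂ x∈q | inj₂ y∈q = q-indep x y x∈q y∈q

IsAlpha-unique : ∀ {n} (G : Graph n) {U k m} → IsAlpha G U k → IsAlpha G U m → k ≡ m
IsAlpha-unique _ ((T , T-stable , refl) , ≤k) ((T′ , T′-stable , refl) , ≤m) =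
  ≤-antisym (≤m T T-stable) (≤k T′ T′-stable)

module Bipartition {n} (side : Fin n → Bool) where

  A B : Subset n
  A = sideA side
  B = sideB side

  ∈A⇒ : ∀ {x} → x ∈ A → side x ≡ true
  ∈A⇒ = ∈-tabulate⁻ side

  ∈B⇒ : ∀ {x} → x ∈ B → side x ≡ false
  ∈B⇒ {x} x∈B with side x | ∈-tabulate⁻ (not ∘ side) x∈B
  ... | false | _ = refl

  A-or-B : ∀ x → x ∈ A ⊎ x ∈ B
  A-or-B x with side x in side-x
  ... | true  = inj₁ (∈-tabulate⁺ side side-x)
  ... | false = inj₂ (∈-tabulate⁺ (not ∘ side) (cong not side-x))

  ∈A⇒∉B : ∀ {x} → x ∈ A → x ∉ B
  ∈A⇒∉B x∈A x∈B with trans (sym (∈A⇒ x∈A)) (∈B⇒ x∈B)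
  ... | ()

  Empty-∩-sides : ∀ {p q} → p ⊆ A → q ⊆ B → Empty (p ∩ q)
  Empty-∩-sides {p} {q} p⊆A q⊆B (x , x∈p∩q) =
    ∈A⇒∉B (p⊆A (proj₁ (x∈p∩q⁻ p q x∈p∩q))) (q⊆B (proj₂ (x∈p∩q⁻ p q x∈p∩q)))

  ∣p∣≡∣p∩A∣+∣p∩B∣ : ∀ p → ∣ p ∣ ≡ ∣ p ∩ A ∣ + ∣ p ∩ B ∣
  ∣p∣≡∣p∩A∣+∣p∩B∣ p =
    trans (cong ∣_∣ (⊆-antisym p⊆ (∪-least (p∩q⊆p p A) (p∩q⊆p p B))))
          (∣p∪q∣≡∣p∣+∣q∣ (p ∩ A) (p ∩ B) (Empty-∩-sides (p∩q⊆q p A) (p∩q⊆q p B)))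
    where
    p⊆ : p ⊆ p ∩ A ∪ p ∩ B
    p⊆ {x} x∈p = x∈p∪q⁺ ([ (λ x∈A → inj₁ (x∈p∩q⁺ (x∈p , x∈A)))
                          , (λ x∈B → inj₂ (x∈p∩q⁺ (x∈p , x∈B))) ]′ (A-or-B x))

  infixr 6 _∪ᴬ∩ᴮ_ _∩ᴬ∪ᴮ_

  _∪ᴬ∩ᴮ_ _∩ᴬ∪ᴮ_ : Subset n → Subset n → Subset n
  p ∪ᴬ∩ᴮ q = (p ∩ A ∪ q ∩ A) ∪ ((p ∩ B) ∩ (q ∩ B))
  p ∩ᴬ∪ᴮ q = ((p ∩ A) ∩ (q ∩ A)) ∪ (p ∩ B ∪ q ∩ B)

  ∣p∣+∣q∣≡∣p∩ᴬ∪ᴮq∣+∣p∪ᴬ∩ᴮq∣ : ∀ p q → ∣ p ∣ + ∣ q ∣ ≡ ∣ p ∩ᴬ∪ᴮ q ∣ + ∣ p ∪ᴬ∩ᴮ q ∣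
  ∣p∣+∣q∣≡∣p∩ᴬ∪ᴮq∣+∣p∪ᴬ∩ᴮq∣ p q = begin
    ∣ p ∣ + ∣ q ∣
      ≡⟨ cong₂ _+_ (∣p∣≡∣p∩A∣+∣p∩B∣ p) (∣p∣≡∣p∩A∣+∣p∩B∣ q) ⟩
    (∣ pᴬ ∣ + ∣ pᴮ ∣) + (∣ qᴬ ∣ + ∣ qᴮ ∣)
      ≡⟨ interchange (∣ pᴬ ∣) (∣ pᴮ ∣) (∣ qᴬ ∣) (∣ qᴮ ∣) ⟩
    (∣ pᴬ ∣ + ∣ qᴬ ∣) + (∣ pᴮ ∣ + ∣ qᴮ ∣)
      ≡⟨ cong₂ _+_ (∣p∪q∣+∣p∩q∣≡∣p∣+∣q∣ pᴬ qᴬ) (∣p∪q∣+∣p∩q∣≡∣p∣+∣q∣ pᴮ qᴮ) ⟨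
    (∣ pᴬ ∪ qᴬ ∣ + ∣ pᴬ ∩ qᴬ ∣) + (∣ pᴮ ∪ qᴮ ∣ + ∣ pᴮ ∩ qᴮ ∣)
      ≡⟨ cong (_+ (∣ pᴮ ∪ qᴮ ∣ + ∣ pᴮ ∩ qᴮ ∣)) (+-comm (∣ pᴬ ∪ qᴬ ∣) (∣ pᴬ ∩ qᴬ ∣)) ⟩
    (∣ pᴬ ∩ qᴬ ∣ + ∣ pᴬ ∪ qᴬ ∣) + (∣ pᴮ ∪ qᴮ ∣ + ∣ pᴮ ∩ qᴮ ∣)
      ≡⟨ interchange (∣ pᴬ ∩ qᴬ ∣) (∣ pᴬ ∪ qᴬ ∣) (∣ pᴮ ∪ qᴮ ∣) (∣ pᴮ ∩ qᴮ ∣) ⟩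
    (∣ pᴬ ∩ qᴬ ∣ + ∣ pᴮ ∪ qᴮ ∣) + (∣ pᴬ ∪ qᴬ ∣ + ∣ pᴮ ∩ qᴮ ∣)
      ≡⟨ cong₂ _+_
           (∣p∪q∣≡∣p∣+∣q∣ _ _ (Empty-∩-sides ([p∩r]∩[q∩r]⊆r p q A) (p∩r∪q∩r⊆r p q B)))
           (∣p∪q∣≡∣p∣+∣q∣ _ _ (Empty-∩-sides (p∩r∪q∩r⊆r p q A) ([p∩r]∩[q∩r]⊆r p q B))) ⟨
    ∣ p ∩ᴬ∪ᴮ q ∣ + ∣ p ∪ᴬ∩ᴮ q ∣
      ∎
    where
    open ≡-Reasoning
    pᴬ qᴬ pᴮ qᴮ : Subset n
    pᴬ = p ∩ A
    qᴬ = q ∩ A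
    pᴮ = p ∩ B
    qᴮ = q ∩ B

  module _ (G : Graph n) (bip : IsBipartition G side) where

    A-indep : ∀ {x y} → x ∈ A → y ∈ A → ¬ Adj G x y
    A-indep {x} {y} x∈A y∈A x~y = bip x y x~y (trans (∈A⇒ x∈A) (sym (∈A⇒ y∈A)))

    B-indep : ∀ {x y} → x ∈ B → y ∈ B → ¬ Adj G x y
    B-indep {x} {y} x∈B y∈B x~y = bip x y x~y (trans (∈B⇒ x∈B) (sym (∈B⇒ y∈B)))

    ∪ᴬ∩ᴮ-stable : ∀ {p q} → Stable G ⊤ p → Stable G ⊤ q → Stable G ⊤ (p ∪ᴬ∩ᴮ q)
    ∪ᴬ∩ᴮ-stable {p} {q} (_ , p-indep) (_ , q-indep) =
      ∪-stable G (⊆⊤ , λ x y x∈ y∈ → A-indep (p∩r∪q∩r⊆r p q A x∈) (p∩r∪q∩r⊆r p q A y∈))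
                 (⊆⊤ , λ x y x∈ y∈ → B-indep ([p∩r]∩[q∩r]⊆r p q B x∈) ([p∩r]∩[q∩r]⊆r p q B y∈))
                 cross
      where
      cross : ∀ x y → x ∈ p ∩ A ∪ q ∩ A → y ∈ (p ∩ B) ∩ (q ∩ B) → ¬ Adj G x y
      cross x y x∈ y∈ with x∈p∪q⁻ (p ∩ A) (q ∩ A) x∈ | x∈p∩q⁻ (p ∩ B) (q ∩ B) y∈
      ... | inj₁ x∈pᴬ | y∈pᴮ , _ = p-indep x y (p∩q⊆p p A x∈pᴬ) (p∩q⊆p p B y∈pᴮ)
      ... | inj₂ x∈qᴬ | _ , y∈qᴮ = q-indep x y (p∩q⊆p q A x∈qᴬ) (p∩q⊆p q B y∈qᴮ)

    module _ {S} (S-stable : Stable G ⊤ S) (S-maximum : ∀ T → Stable G ⊤ T → ∣ T ∣ ≤ ∣ S ∣) where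

      X Sᴮ U : Subset n
      X = S ∩ A
      Sᴮ = S ∩ B
      U = X ∪ (B ─ S)

      α[G] : IsAlpha G ⊤ ∣ S ∣
      α[G] = (S , S-stable , refl) , S-maximum

      X-stable : ∀ {H} → H ⊑ G → Stable H U X
      X-stable H⊑G = p⊆p∪q (B ─ S) , proj₂ (Stable-⊑ H⊑G (Stable-⊆ G (p∩q⊆p S A) S-stable))

      Sᴮ-stable : Stable G ⊤ Sᴮ
      Sᴮ-stable = Stable-⊆ G (p∩q⊆p S B) S-stable

      U≁Sᴮ : ∀ x y → x ∈ U → y ∈ Sᴮ → ¬ Adj G x y
      U≁Sᴮ x y x∈U y∈Sᴮ with x∈p∪q⁻ X (B ─ S) x∈U
      ... | inj₁ x∈X   = proj₂ S-stable x y (p∩q⊆p S A x∈X) (p∩q⊆p S B y∈Sᴮ)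
      ... | inj₂ x∈B─S = B-indep (p─q⊆p B S x∈B─S) (p∩q⊆q S B y∈Sᴮ)

      Empty-U∩Sᴮ : ∀ {T} → T ⊆ U → Empty (T ∩ Sᴮ)
      Empty-U∩Sᴮ {T} T⊆U (x , x∈T∩Sᴮ) with x∈p∩q⁻ T Sᴮ x∈T∩Sᴮ
      ... | x∈T , x∈Sᴮ with x∈p∪q⁻ X (B ─ S) (T⊆U x∈T)
      ...   | inj₁ x∈X   = ∈A⇒∉B (p∩q⊆q S A x∈X) (p∩q⊆q S B x∈Sᴮ)
      ...   | inj₂ x∈B─S = x∈p─q⇒x∉q x∈B─S (p∩q⊆p S B x∈Sᴮ)

      stable-in-U-bound : ∀ {H} → H ⊑ G → (∀ T → Stable H ⊤ T → ∣ T ∣ ≤ ∣ S ∣) →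
                          ∀ T → Stable H U T → ∣ T ∣ ≤ ∣ X ∣
      stable-in-U-bound {H} H⊑G α[H]≤∣S∣ T (T⊆U , T-indep) = +-cancelʳ-≤ (∣ Sᴮ ∣) (∣ T ∣) (∣ X ∣) (begin
        ∣ T ∣ + ∣ Sᴮ ∣  ≡⟨ ∣p∪q∣≡∣p∣+∣q∣ T Sᴮ (Empty-U∩Sᴮ T⊆U) ⟨
        ∣ T ∪ Sᴮ ∣      ≤⟨ α[H]≤∣S∣ (T ∪ Sᴮ) T∪Sᴮ-stable ⟩
        ∣ S ∣           ≡⟨ ∣p∣≡∣p∩A∣+∣p∩B∣ S ⟩
        ∣ X ∣ + ∣ Sᴮ ∣  ∎)
        where
        open ≤-Reasoning
        T∪Sᴮ-stable : Stable H ⊤ (T ∪ Sᴮ)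
        T∪Sᴮ-stable = ∪-stable H (⊆⊤ , T-indep) (Stable-⊑ H⊑G Sᴮ-stable)
                               (λ x y x∈T y∈Sᴮ → U≁Sᴮ x y (T⊆U x∈T) y∈Sᴮ ∘ ⊑⇒Adj H⊑G x y)

      α[U] : IsAlpha G U ∣ X ∣
      α[U] = (X , X-stable ⊑-refl , refl) , stable-in-U-bound ⊑-refl S-maximum

      ∣X∣≤∣T∩U∣ : ∀ T → Stable G ⊤ T → ∣ S ∣ ≤ ∣ T ∣ → ∣ X ∣ ≤ ∣ T ∩ U ∣
      ∣X∣≤∣T∩U∣ T T-stable ∣S∣≤∣T∣ = +-cancelʳ-≤ (∣ Sᴮ ∣) (∣ X ∣) (∣ T ∩ U ∣) (begin
        ∣ X ∣ + ∣ Sᴮ ∣      ≡⟨ ∣p∣≡∣p∩A∣+∣p∩B∣ S ⟨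
        ∣ S ∣               ≤⟨ ∣S∣≤∣T∣ ⟩
        ∣ T ∣               ≤⟨ ∣T∣≤∣S∩ᴬ∪ᴮT∣ ⟩
        ∣ S ∩ᴬ∪ᴮ T ∣        ≤⟨ p⊆q⇒∣p∣≤∣q∣ S∩ᴬ∪ᴮT⊆T∩U∪Sᴮ ⟩
        ∣ T ∩ U ∪ Sᴮ ∣      ≤⟨ ∣p∪q∣≤∣p∣+∣q∣ (T ∩ U) Sᴮ ⟩
        ∣ T ∩ U ∣ + ∣ Sᴮ ∣  ∎)
        where
        open ≤-Reasoning
        ∣T∣≤∣S∩ᴬ∪ᴮT∣ : ∣ T ∣ ≤ ∣ S ∩ᴬ∪ᴮ T ∣
        ∣T∣≤∣S∩ᴬ∪ᴮT∣ = +-cancelˡ-≤ (∣ S ∣) (∣ T ∣) (∣ S ∩ᴬ∪ᴮ T ∣) (begin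
          ∣ S ∣ + ∣ T ∣                ≡⟨ ∣p∣+∣q∣≡∣p∩ᴬ∪ᴮq∣+∣p∪ᴬ∩ᴮq∣ S T ⟩
          ∣ S ∩ᴬ∪ᴮ T ∣ + ∣ S ∪ᴬ∩ᴮ T ∣  ≤⟨ +-monoʳ-≤ (∣ S ∩ᴬ∪ᴮ T ∣) (S-maximum _ (∪ᴬ∩ᴮ-stable S-stable T-stable)) ⟩
          ∣ S ∩ᴬ∪ᴮ T ∣ + ∣ S ∣         ≡⟨ +-comm (∣ S ∩ᴬ∪ᴮ T ∣) (∣ S ∣) ⟩
          ∣ S ∣ + ∣ S ∩ᴬ∪ᴮ T ∣         ∎)
        S∩ᴬ∪ᴮT⊆T∩U∪Sᴮ : S ∩ᴬ∪ᴮ T ⊆ T ∩ U ∪ Sᴮ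
        S∩ᴬ∪ᴮT⊆T∩U∪Sᴮ {x} x∈ with x∈p∪q⁻ ((S ∩ A) ∩ (T ∩ A)) (S ∩ B ∪ T ∩ B) x∈
        ... | inj₁ x∈Sᴬ∩Tᴬ = x∈p∪q⁺ (inj₁ (x∈p∩q⁺
                (p∩q⊆p T A (p∩q⊆q (S ∩ A) (T ∩ A) x∈Sᴬ∩Tᴬ) , p⊆p∪q (B ─ S) (p∩q⊆p (S ∩ A) (T ∩ A) x∈Sᴬ∩Tᴬ))))
        ... | inj₂ x∈Sᴮ∪Tᴮ with x∈p∪q⁻ (S ∩ B) (T ∩ B) x∈Sᴮ∪Tᴮ
        ...   | inj₁ x∈Sᴮ = x∈p∪q⁺ (inj₂ x∈Sᴮ)
        ...   | inj₂ x∈Tᴮ with x ∈? S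
        ...     | yes x∈S = x∈p∪q⁺ (inj₂ (x∈p∩q⁺ (x∈S , p∩q⊆q T B x∈Tᴮ)))
        ...     | no  x∉S = x∈p∪q⁺ (inj₁ (x∈p∩q⁺ (p∩q⊆p T B x∈Tᴮ , q⊆p∪q X (B ─ S) x∈B─S)))
          where
          x∈B─S : x ∈ B ─ S
          x∈B─S = x∈p∧x∉q⇒x∈p─q (p∩q⊆q T B x∈Tᴮ) x∉S

      minus-stable : AlphaMinusStable G ⊤ → AlphaMinusStable G U
      minus-stable α⁻ x y _ _ x~y k α[U]≡k with IsAlpha-unique G α[U] α[U]≡k
      ... | refl = (X , X-stable G⁻⊑G , refl) ,
                   stable-in-U-bound G⁻⊑G (proj₂ (α⁻ x y ∈⊤ ∈⊤ x~y ∣ S ∣ α[G]))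
        where
        G⁻⊑G : deleteEdge G x y ⊑ G
        G⁻⊑G = deleteEdge-⊑ G x y

      plus-stable : AlphaPlusStable G ⊤ → AlphaPlusStable G U
      plus-stable α⁺ x y _ _ x≢y x≁y k α[U]≡k
        with IsAlpha-unique G α[U] α[U]≡k | α⁺ x y ∈⊤ ∈⊤ x≢y x≁y ∣ S ∣ α[G]
      ... | refl | (T , T-stable , ∣T∣≡∣S∣) , _ =
        (T ∩ U , T∩U-stable ,
         ≤-antisym (bound (T ∩ U) T∩U-stable)
                   (∣X∣≤∣T∩U∣ T (Stable-⊑ G⊑G⁺ T-stable) (≤-reflexive (sym ∣T∣≡∣S∣)))) ,
        bound
        where
        G⁺ : Graph n
        G⁺ = addEdge G x y x≢y
        G⊑G⁺ : G ⊑ G⁺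
        G⊑G⁺ = ⊑-addEdge G x y x≢y
        T∩U-stable : Stable G⁺ U (T ∩ U)
        T∩U-stable = p∩q⊆q T U , proj₂ (Stable-⊆ G⁺ (p∩q⊆p T U) T-stable)
        bound : ∀ T′ → Stable G⁺ U T′ → ∣ T′ ∣ ≤ ∣ X ∣
        bound T′ = stable-in-U-bound ⊑-refl S-maximum T′ ∘ Stable-⊑ G⊑G⁺

lemma1 : ∀ {n} (G : Graph n) (side : Fin n → Bool) → IsBipartition G side →
    AlphaStable G ⊤ →
    (S : Subset n) → MaxStable G ⊤ S →
    Nonempty (S ∩ sideA side) → Nonempty (S ∩ sideB side) →
    AlphaStable G ((S ∩ sideA side) ∪ (sideB side ─ S))
lemma1 G side bip (α⁻ , α⁺) S (S-stable , S-maximum) _ _ =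
  minus-stable G bip S-stable S-maximum α⁻ , plus-stable G bip S-stable S-maximum α⁺
  where open Bipartition side
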